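{- Let $G=(V,E^+\cup\mathrm{out}(I),w)$, where $I$ is a $1$-hop independent set of negative vertices of $G$, and suppose $w(e)\ge0$ for all $e\in E^+$. Then the price function $\phi(v)=\mathrm{dist}^1_G(V,v)$ is a valid price function that eliminates all negative-weight edges from $G$; that is, $w_\phi(e)\ge 0$ for every edge $e$ of $G$.
   Context: $G=(V,E^+\cup \mathrm{out}(I),w)$ is a directed graph with real weights whose edge set is partitioned into nonnegative edges $E^+$ and negative edges $\mathrm{out}(I)=\{(x,y): x\in I\}$ (the outgoing edges of vertices of $I$); the vertices of $I$ are the negative vertices. Paths need not be simple; a $1$-hop path contains at most one negative edge (with multiplicity). $\mathrm{dist}^1_G(u,v)$ is the minimum weight of a $1$-hop $u$-to-$v$ path ($\infty$ if none), and $\mathrm{dist}^1_G(V,v)=\min_{u\in V}\mathrm{dist}^1_G(u,v)$. Vertices $u,v$ are $1$-hop related if $\mathrm{dist}^1_G(u,v)<0$ or $\mathrm{dist}^1_G(v,u)<0$; $I$ is $1$-hop independent if no $x,y\in I$ (including $x=y$) are $1$-hop related. A price function $\phi$ gives $w_\phi(u,v)=w(u,v)+\phi(u)-\phi(v)$; it is valid if $w_\phi(e)\ge0$ for all $e\in E^+$.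
   Formalization: The edge weights of G are rational instead of real. -}

module Defs where

open import Data.Nat using (ℕ; zero; suc)
import Data.Nat as ℕ
open import Data.Fin using (Fin)
open import Data.Rational using (ℚ; 0ℚ; _+_; _-_; _≤_; _<_)
open import Data.Product using (Σ; _×_; ∃; ∃-syntax; _,_)
open import Data.Sum using (_⊎_)
open import Relation.Nullary using (¬_)
open import Relation.Binary.PropositionalEquality using (_≡_)

-- A directed graph on the vertex set V = Fin n with edge relation E,
-- weights w (rational, standing in for reals) and a set I of negative vertices.
-- The edge set is partitioned into out(I) = edges whose source is in I, and
-- E⁺ = the remaining edges (those whose source is not in I).
record Graph (n : ℕ) : Set₁ where
  field
    E : Fin n → Fin n → Set
    w : Fin n → Fin n → ℚ
    I : Fin n → Set

module _ {n : ℕ} (G : Graph n) where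
  open Graph G

  -- Walks (paths, not necessarily simple) from u to v, indexed by the number
  -- of negative edges (edges in out(I)) used, counted with multiplicity.
  data Walk : ℕ → Fin n → Fin n → Set where
    nil : ∀ {v} → Walk 0 v v
    pos : ∀ {k u x v} → ¬ I u → E u x → Walk k x v → Walk k u v
    neg : ∀ {k u x v} → I u → E u x → Walk k x v → Walk (suc k) u v

  weight : ∀ {k u v} → Walk k u v → ℚ
  weight nil = 0ℚ
  weight (pos {u = u} {x = x} _ _ p) = w u x + weight p
  weight (neg {u = u} {x = x} _ _ p) = w u x + weight p

  OneHopPath : Fin n → Fin n → Set
  OneHopPath u v = Σ ℕ λ k → (k ℕ.≤ 1) × Walk k u v

  hopWeight : ∀ {u v} → OneHopPath u v → ℚ
  hopWeight (_ , _ , p) = weight p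

  -- dist¹_G(u,v) < 0 : the minimum (infimum) over 1-hop u-v paths is negative,
  -- i.e. some 1-hop u-v path has negative weight
  Dist1Neg : Fin n → Fin n → Set
  Dist1Neg u v = Σ (OneHopPath u v) λ p → hopWeight p < 0ℚ

  OneHopRelated : Fin n → Fin n → Set
  OneHopRelated u v = Dist1Neg u v ⊎ Dist1Neg v u

  OneHopIndependent : Set
  OneHopIndependent = ∀ x y → I x → I y → ¬ OneHopRelated x y

  -- d = dist¹_G(V,v): d is the minimum weight of a 1-hop path ending at v
  -- (attained by some path starting at some u ∈ V, and a lower bound for all)
  IsDist1FromV : Fin n → ℚ → Set
  IsDist1FromV v d =
    (Σ (Fin n) λ u → Σ (OneHopPath u v) λ p → hopWeight p ≡ d)
    × (∀ u (p : OneHopPath u v) → d ≤ hopWeight p)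

  wφ : (Fin n → ℚ) → Fin n → Fin n → ℚ
  wφ φ u v = w u v + φ u - φ v

  ValidPrice : (Fin n → ℚ) → Set
  ValidPrice φ = ∀ u v → E u v → ¬ I u → 0ℚ ≤ wφ φ u v

  NonnegE⁺ : Set
  NonnegE⁺ = ∀ u v → E u v → ¬ I u → 0ℚ ≤ w u v

{-# OPTIONS --safe #-}
-- To see φ v ≤ φ u + w(u,v) for an edge (u,v), extend a minimal 1-hop walk into u
-- by that edge. The result is still 1-hop unless u ∈ I and the walk has already
-- used a negative edge, leaving from some x ∈ I; then the walk is nonnegative (its
-- part from x by independence of x and u, the rest since w ≥ 0 on E⁺), so φ u ≥ 0
-- and the edge alone gives φ v ≤ w(u,v) ≤ φ u + w(u,v).
-- Membership in I need not be decidable, but the goal is a decidable inequality of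
-- rationals, so this case split is constructively admissible.
module Submission where

open import Defs
open import Data.Nat using (ℕ; z≤n; s≤s)
import Data.Nat as ℕ
import Data.Nat.Properties as ℕ
open import Data.Fin using (Fin)
open import Data.Rational using (ℚ; 0ℚ; _≤_; _+_; _-_; -_)
open import Data.Rational.Properties
  using (_≤?_; ≤-trans; ≮⇒≥; +-mono-≤; +-monoˡ-≤; +-identityˡ; +-identityʳ; +-inverseʳ; +-assoc; +-comm)
open import Data.Product using (_×_; _,_)
open import Data.Sum using (inj₁)
open import Relation.Nullary using (Dec; yes; no)
open import Relation.Nullary.Decidable using (decidable-stable; ¬¬-excluded-middle)
open import Relation.Nullary.Negation using (¬¬-map)
open import Relation.Binary.PropositionalEquality using (_≡_; sym; trans; cong; subst)

p≤q⇒0≤q-p : ∀ {p q} → p ≤ q → 0ℚ ≤ q - p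
p≤q⇒0≤q-p {p} {q} p≤q = subst (_≤ q - p) (+-inverseʳ p) (+-monoˡ-≤ (- p) p≤q)

module _ {n : ℕ} (G : Graph n) where
  open Graph G

  infixr 5 _++_
  _++_ : ∀ {k m x u v} → Walk G k x u → Walk G m u v → Walk G (k ℕ.+ m) x v
  nil         ++ q = q
  pos ¬iu e p ++ q = pos ¬iu e (p ++ q)
  neg iu e p  ++ q = neg iu e (p ++ q)

  weight-++ : ∀ {k m x u v} (p : Walk G k x u) (q : Walk G m u v) →
              weight G (p ++ q) ≡ weight G p + weight G q
  weight-++ nil q = sym (+-identityˡ (weight G q))
  weight-++ (pos {u = a} {x = b} _ _ p) q =
    trans (cong (w a b +_) (weight-++ p q)) (sym (+-assoc (w a b) (weight G p) (weight G q)))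
  weight-++ (neg {u = a} {x = b} _ _ p) q =
    trans (cong (w a b +_) (weight-++ p q)) (sym (+-assoc (w a b) (weight G p) (weight G q)))

  dist1-≤-++ : ∀ {d k m x u v} → IsDist1FromV G v d → k ℕ.+ m ℕ.≤ 1 →
               (p : Walk G k x u) (q : Walk G m u v) → d ≤ weight G p + weight G q
  dist1-≤-++ {d} (_ , minimal) k+m≤1 p q =
    subst (d ≤_) (weight-++ p q) (minimal _ (_ , k+m≤1 , p ++ q))

  oneHop-into-I-nonneg : OneHopIndependent G → NonnegE⁺ G →
                         ∀ {x u} → I u → (p : Walk G 1 x u) → 0ℚ ≤ weight G p
  oneHop-into-I-nonneg independent nonneg iu (pos {u = a} {x = b} ¬ia e p) =
    +-mono-≤ (nonneg a b e ¬ia) (oneHop-into-I-nonneg independent nonneg iu p)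
  oneHop-into-I-nonneg independent nonneg {u = u} iu p@(neg {u = a} ia _ _) =
    ≮⇒≥ (λ p<0 → independent a u ia iu (inj₁ ((1 , ℕ.≤-refl , p) , p<0)))

  dist1-≤-extend : OneHopIndependent G → NonnegE⁺ G →
                   ∀ {d k x u v} → IsDist1FromV G v d → k ℕ.≤ 1 →
                   (p : Walk G k x u) → E u v → d ≤ weight G p + w u v
  dist1-≤-extend independent nonneg {d} {x = x} {u} {v} dist k≤1 p e =
    decidable-stable (d ≤? weight G p + w u v)
      (¬¬-map (λ iu? → subst (λ c → d ≤ weight G p + c) (+-identityʳ (w u v)) (extend iu? k≤1 p))
              ¬¬-excluded-middle)
    where
    extend : ∀ {k} → Dec (I u) → k ℕ.≤ 1 → (p : Walk G k x u) → d ≤ weight G p + (w u v + 0ℚ)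
    extend {k} (no ¬iu) k≤1 p =
      dist1-≤-++ dist (subst (ℕ._≤ 1) (sym (ℕ.+-identityʳ k)) k≤1) p (pos ¬iu e nil)
    extend (yes iu) z≤n p = dist1-≤-++ dist ℕ.≤-refl p (neg iu e nil)
    extend (yes iu) (s≤s z≤n) p =
      ≤-trans (dist1-≤-++ dist ℕ.≤-refl nil (neg iu e nil))
              (+-monoˡ-≤ (w u v + 0ℚ) (oneHop-into-I-nonneg independent nonneg iu p))

lemma3p12 : {n : ℕ} (G : Graph n) → OneHopIndependent G → NonnegE⁺ G →
    (φ : Fin n → ℚ) → (∀ v → IsDist1FromV G v (φ v)) →
    ValidPrice G φ × (∀ u v → Graph.E G u v → 0ℚ ≤ wφ G φ u v)
lemma3p12 G independent nonneg φ φ-dist = (λ u v e _ → reduced-nonneg u v e) , reduced-nonneg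
  where
  open Graph G
  reduced-nonneg : ∀ u v → E u v → 0ℚ ≤ wφ G φ u v
  reduced-nonneg u v e with φ-dist u
  ... | (_ , (_ , k≤1 , p) , weight≡φu) , _ =
    p≤q⇒0≤q-p (subst (φ v ≤_) (trans (cong (_+ w u v) weight≡φu) (+-comm (φ u) (w u v)))
                              (dist1-≤-extend G independent nonneg (φ-dist v) k≤1 p e))
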